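{- Let $n\geq 3$, $G=\langle x,y:~x^n=y^2=e,~yxy=x^{ -1}\rangle$, $A=\langle x\rangle$, let $D$ be a difference set in $A$, and let $\Gamma=\mathrm{Cay}(G,A^\#\cup yD)$. If $\Gamma$ is a strictly Deza graph, then $\Gamma$ has parameters $(2n,n-1+k,2k,2(k-1))$, where $k=\frac{2n-1-\sqrt{8n-7}}{2}$; that is, $\Gamma$ has $2n$ vertices, is $(n-1+k)$-regular, and every pair of distinct vertices has either $2k$ or $2(k-1)$ common neighbours.
   Context: $G^\#=G\setminus\{e\}$; $\mathrm{Cay}(G,S)$ has vertex set $G$ and edges $\{g,sg\}$, $s\in S$. A subset $D$ of a group $H$ is a difference set if there is a positive integer $\lambda$ such that every element of $H\setminus\{e\}$ is $d_1^{ -1}d_2$ ($d_1,d_2\in D$) in exactly $\lambda$ ways. A $k$-regular graph on $n$ vertices is a Deza graph with parameters $(n,k,b,a)$ if every pair of distinct vertices has either $a$ or $b$ common neighbours. A strictly Deza graph is a Deza graph which is not strongly regular and has diameter $2$. -}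

module Defs where

open import Data.Nat using (ℕ; zero; suc; _+_; _*_; _∸_; _≤_; _<_; NonZero)
open import Data.Nat.DivMod using (_mod_)
open import Data.Fin using (Fin; toℕ)
open import Data.Fin.Subset using (Subset)
import Data.Fin.Properties as FinP
open import Data.Bool using (Bool; true; false; not; _∧_; _∨_; _xor_; if_then_else_; T)
import Data.Bool.Properties as BoolP
open import Data.List using (List; filter; length; allFin; cartesianProduct; map; _++_)
open import Data.Bool.ListAction using (any)
open import Data.Vec using (lookup)
open import Data.Product using (Σ; ∃; _×_; _,_; proj₁; proj₂)
open import Data.Product.Properties using (≡-dec)
open import Data.Sum using (_⊎_)
open import Relation.Nullary using (¬_; Dec)
open import Relation.Nullary.Decidable using (⌊_⌋; T?)
open import Relation.Binary.PropositionalEquality using (_≡_; _≢_)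

-- Finite simple graphs given by an enumeration of the vertices
-- (a duplicate-free list of all vertices) and a Boolean adjacency.

record Graph : Set₁ where
  field
    V     : Set
    verts : List V
    adj   : V → V → Bool

module _ (Γ : Graph) where
  open Graph Γ

  order : ℕ
  order = length verts

  degree : V → ℕ
  degree u = length (filter (λ w → T? (adj u w)) verts)

  common : V → V → ℕ
  common u v = length (filter (λ w → T? (adj u w ∧ adj v w)) verts)

  IsRegular : ℕ → Set
  IsRegular k = ∀ u → degree u ≡ k

  IsDezaWith : ℕ → ℕ → ℕ → ℕ → Set
  IsDezaWith n k b a =
    order ≡ n × IsRegular k ×
    (∀ u v → u ≢ v → common u v ≡ a ⊎ common u v ≡ b)

  IsDeza : Set
  IsDeza = Σ ℕ λ k → Σ ℕ λ b → Σ ℕ λ a → IsDezaWith order k b a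

  IsStronglyRegular : Set
  IsStronglyRegular = Σ ℕ λ k → Σ ℕ λ l → Σ ℕ λ m →
    IsRegular k ×
    (∀ u v → u ≢ v → T (adj u v) → common u v ≡ l) ×
    (∀ u v → u ≢ v → ¬ T (adj u v) → common u v ≡ m)

  HasDiameter2 : Set
  HasDiameter2 =
    (∀ u v → u ≢ v → T (adj u v) ⊎ (∃ λ w → T (adj u w) × T (adj w v))) ×
    (∃ λ u → ∃ λ v → u ≢ v × ¬ T (adj u v))

  IsStrictlyDeza : Set
  IsStrictlyDeza = IsDeza × ¬ IsStronglyRegular × HasDiameter2

-- The dihedral group G = ⟨x,y : xⁿ = y² = e, yxy = x⁻¹⟩ of order 2n,
-- with the element x^i y^b represented as (i , b), i ∈ ℤ/n, b ∈ {0,1}.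

module Dihedral (n : ℕ) ⦃ nz : NonZero n ⦄ where

  Zn : Set
  Zn = Fin n

  _⊕_ : Zn → Zn → Zn
  i ⊕ j = (toℕ i + toℕ j) mod n

  ⊖_ : Zn → Zn
  ⊖ i = (n ∸ toℕ i) mod n

  0z : Zn
  0z = 0 mod n

  G : Set
  G = Zn × Bool

  _≟G_ : (g h : G) → Dec (g ≡ h)
  _≟G_ = ≡-dec FinP._≟_ BoolP._≟_

  _==_ : G → G → Bool
  g == h = ⌊ g ≟G h ⌋

  -- (x^i y^a)(x^j y^b) = x^(i ± j) y^(a+b)
  _·_ : G → G → G
  (i , a) · (j , b) = (i ⊕ (if a then ⊖ j else j)) , (a xor b)

  _⁻¹ : G → G
  (i , false) ⁻¹ = (⊖ i) , false
  (i , true)  ⁻¹ = i , true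

  e : G
  e = 0z , false

  y : G
  y = 0z , true

  xpow : Zn → G
  xpow d = d , false

  elems : List G
  elems = cartesianProduct (allFin n) (false ∷ᴸ true ∷ᴸ [])
    where
      open import Data.List using ([]) renaming (_∷_ to _∷ᴸ_)

  inA : G → Bool
  inA (i , b) = not b

  -- A subset D of A is given by its set of exponents {d : x^d ∈ D}.
  inD : Subset n → G → Bool
  inD D g = any (λ d → lookup D d ∧ (xpow d == g)) (allFin n)

  IsDifferenceSet : Subset n → Set
  IsDifferenceSet D = Σ ℕ λ λ' → 0 < λ' ×
    (∀ h → T (inA h) → h ≢ e →
      length (filter (λ p → T? (inD D (proj₁ p) ∧ inD D (proj₂ p)
                                ∧ ((((proj₁ p) ⁻¹) · proj₂ p) == h)))
                     (cartesianProduct elems elems)) ≡ λ')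

  inS : Subset n → G → Bool
  inS D g = (inA g ∧ not (g == e))
          ∨ any (λ d → inD D d ∧ ((y · d) == g)) elems

  Cay : Subset n → Graph
  Cay D = record
    { V = G
    ; verts = elems
    ; adj = λ g h → inS D (h · (g ⁻¹)) ∨ inS D (g · (h ⁻¹))
    }

-- Write the vertices as (i , a) for x^i y^a and let k = |D|.  Two vertices of the same coset
-- of A = ⟨x⟩ are adjacent and have n − 2 + λ common neighbours, while (i , a) and (j , 1 − a)
-- are adjacent iff x^(i+j) ∈ D⁻¹ and then have 2(k − 1) common neighbours, otherwise 2k.
-- Counting D × D by quotients gives k² + λ = nλ + k, so k > 0, and a non-adjacent pair gives
-- k < n; hence all three values occur.  A Deza graph has only two, and n − 2 + λ = 2(k − 1)
-- would make Γ strongly regular, so n − 2 + λ = 2k.  Eliminating λ, s = 2(n − k) − 1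
-- satisfies s² = 8n − 7 and 2k + s = 2n − 1.
module Submission where

open import Defs
open import Level using (0ℓ)
open import Algebra.Bundles using (AbelianGroup)
open import Algebra.Structures using (IsAbelianGroup)
open import Data.Bool using (Bool; true; false; not; _∧_; _∨_; T)
import Data.Bool.Properties as BoolP
open import Data.Bool.ListAction using (any)
open import Data.Empty using (⊥-elim)
open import Data.Fin using (Fin; zero; suc; toℕ)
import Data.Fin.Permutation as Perm
import Data.Fin.Properties as FinP
open import Data.Fin.Subset using (Subset)
open import Data.List using (List; []; _∷_; _++_; map; filter; length; tabulate; allFin; cartesianProduct)
open import Data.List.Membership.Propositional using (_∈_; lose)
open import Data.List.Membership.Propositional.Properties using (∈-allFin; ∈-cartesianProduct⁺)
import Data.List.Properties as ListP
open import Data.List.Relation.Unary.Any using (here; there; satisfied)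
open import Data.List.Relation.Unary.Any.Properties using (any⁺; any⁻)
open import Data.Nat using (ℕ; zero; suc; z≤n; s≤s; _+_; _*_; _∸_; _≤_; _<_; NonZero; >-nonZero⁻¹; _%_)
open import Data.Nat.DivMod
import Data.Nat.ListAction as List
open import Data.Nat.ListAction.Properties using (sum-++)
open import Data.Nat.Properties
open import Algebra.Properties.CommutativeSemigroup +-commutativeSemigroup using (xy∙z≈xz∙y)
open import Algebra.Properties.Semiring.Sum +-*-semiring
  using (sum; sum-cong-≗; ∑-distrib-+; ∑-comm; ∑-permute; *-distribˡ-sum; *-distribʳ-sum)
open import Data.Nat.Tactic.RingSolver using (solve-∀)
open import Data.Product using (Σ; ∃; _×_; _,_; proj₁; proj₂)
open import Data.Sum using (_⊎_; inj₁; inj₂; [_,_]′)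
open import Data.Unit using (tt)
open import Data.Vec using (lookup)
open import Function using (_∘_)
open import Function.Bundles using (_⇔_; mk⇔; Equivalence)
open import Relation.Binary.PropositionalEquality
open import Relation.Nullary using (¬_; Dec)
open import Relation.Nullary.Decidable
  using (⌊_⌋; T?; toWitness; fromWitness; does-⇔; dec-true; dec-false; isYes≗does)

𝟙 : Bool → ℕ
𝟙 true  = 1
𝟙 false = 0

𝟙-∧ : ∀ a b → 𝟙 (a ∧ b) ≡ 𝟙 a * 𝟙 b
𝟙-∧ false b = refl
𝟙-∧ true  b = sym (+-identityʳ (𝟙 b))

𝟙-pos⇒≡true : ∀ {b} → 0 < 𝟙 b → b ≡ true
𝟙-pos⇒≡true {true} _ = refl

T⇒≡true : ∀ {b} → T b → b ≡ true
T⇒≡true {true} _ = refl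

¬T⇒≡false : ∀ {b} → ¬ T b → b ≡ false
¬T⇒≡false {false} _ = refl
¬T⇒≡false {true}  ¬t = ⊥-elim (¬t tt)

𝟙-∧-not+𝟙-∧ : ∀ a b → 𝟙 (a ∧ not b) + 𝟙 (a ∧ b) ≡ 𝟙 a
𝟙-∧-not+𝟙-∧ false b     = refl
𝟙-∧-not+𝟙-∧ true  false = refl
𝟙-∧-not+𝟙-∧ true  true  = refl

𝟙-∧-≤ʳ : ∀ a b → 𝟙 (a ∧ b) ≤ 𝟙 b
𝟙-∧-≤ʳ false b = z≤n
𝟙-∧-≤ʳ true  b = ≤-refl

T-∧⁻ : ∀ a {b} → T (a ∧ b) → T a × T b
T-∧⁻ a = Equivalence.to (BoolP.T-∧ {a})

⌊⌋-⇔ : ∀ {A B : Set} → A ⇔ B → (a? : Dec A) (b? : Dec B) → ⌊ a? ⌋ ≡ ⌊ b? ⌋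
⌊⌋-⇔ A⇔B a? b? = trans (isYes≗does a?) (trans (does-⇔ A⇔B a? b?) (sym (isYes≗does b?)))

⌊⌋-true : ∀ {A : Set} (a? : Dec A) → A → ⌊ a? ⌋ ≡ true
⌊⌋-true a? a = trans (isYes≗does a?) (dec-true a? a)

⌊⌋-false : ∀ {A : Set} (a? : Dec A) → ¬ A → ⌊ a? ⌋ ≡ false
⌊⌋-false a? ¬a = trans (isYes≗does a?) (dec-false a? ¬a)

any-≡-false : ∀ {A : Set} (f : A → Bool) xs → (∀ x → ¬ T (f x)) → any f xs ≡ false
any-≡-false f xs ¬f = does-⇔ (mk⇔ (λ t → ¬f _ (proj₂ (satisfied (any⁻ f xs t)))) λ ()) (T? _) (T? false)

any-∧-unique : ∀ {A : Set} (p q : A → Bool) {x} xs → x ∈ xs →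
  (∀ y → T (q y) → y ≡ x) → T (q x) → any (λ y → p y ∧ q y) xs ≡ p x
any-∧-unique p q {x} xs x∈xs unique qx = does-⇔ (mk⇔ to from) (T? _) (T? _)
  where
    to : T (any (λ y → p y ∧ q y) xs) → T (p x)
    to t with satisfied (any⁻ _ xs t)
    ... | y , pqy with T-∧⁻ (p y) pqy
    ...   | py , qy = subst (T ∘ p) (unique y qy) py
    from : T (p x) → T (any (λ y → p y ∧ q y) xs)
    from px = any⁺ _ (lose x∈xs (Equivalence.from BoolP.T-∧ (px , qx)))

length-filter-T? : ∀ {A : Set} (p : A → Bool) xs →
  length (filter (λ x → T? (p x)) xs) ≡ List.sum (map (λ x → 𝟙 (p x)) xs)
length-filter-T? p []       = refl
length-filter-T? p (x ∷ xs) with p x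
... | true  = cong suc (length-filter-T? p xs)
... | false = length-filter-T? p xs

sum-map-cartesianProduct : ∀ {A B : Set} (h : A × B → ℕ) xs ys →
  List.sum (map h (cartesianProduct xs ys)) ≡
  List.sum (map (λ x → List.sum (map (λ y → h (x , y)) ys)) xs)
sum-map-cartesianProduct h []       ys = refl
sum-map-cartesianProduct h (x ∷ xs) ys = begin
  List.sum (map h (map (x ,_) ys ++ cartesianProduct xs ys))
    ≡⟨ cong List.sum (ListP.map-++ h (map (x ,_) ys) _) ⟩
  List.sum (map h (map (x ,_) ys) ++ map h (cartesianProduct xs ys))
    ≡⟨ sum-++ (map h (map (x ,_) ys)) _ ⟩
  List.sum (map h (map (x ,_) ys)) + List.sum (map h (cartesianProduct xs ys))
    ≡⟨ cong₂ _+_ (cong List.sum (sym (ListP.map-∘ ys))) (sum-map-cartesianProduct h xs ys) ⟩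
  List.sum (map (λ y → h (x , y)) ys) + _
    ∎
  where open ≡-Reasoning

length-cartesianProduct : ∀ {A B : Set} (xs : List A) (ys : List B) →
  length (cartesianProduct xs ys) ≡ length xs * length ys
length-cartesianProduct []       ys = refl
length-cartesianProduct (x ∷ xs) ys = begin
  length (map (x ,_) ys ++ cartesianProduct xs ys)      ≡⟨ ListP.length-++ (map (x ,_) ys) ⟩
  length (map (x ,_) ys) + length (cartesianProduct xs ys)
    ≡⟨ cong₂ _+_ (ListP.length-map (x ,_) ys) (length-cartesianProduct xs ys) ⟩
  length ys + length xs * length ys                      ∎
  where open ≡-Reasoning

sum-map-tabulate : ∀ {A : Set} {n} (h : A → ℕ) (f : Fin n → A) →
  List.sum (map h (tabulate f)) ≡ sum (λ i → h (f i))
sum-map-tabulate {n = zero}  h f = refl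
sum-map-tabulate {n = suc n} h f = cong (h (f zero) +_) (sum-map-tabulate h (λ i → f (suc i)))

sum-const : ∀ n c → sum {n} (λ _ → c) ≡ n * c
sum-const zero    c = refl
sum-const (suc n) c = cong (c +_) (sum-const n c)

sum-zero : ∀ {n} (f : Fin n → ℕ) → (∀ i → f i ≡ 0) → sum f ≡ 0
sum-zero {n} f f≗0 = trans (sum-cong-≗ f≗0) (trans (sum-const n 0) (*-zeroʳ n))

sum-delta : ∀ {n} (f : Fin n → ℕ) i → (∀ j → j ≢ i → f j ≡ 0) → sum f ≡ f i
sum-delta {suc n} f zero    f≡0 =
  trans (cong (f zero +_) (sum-zero _ (λ j → f≡0 (suc j) λ ()))) (+-identityʳ _)
sum-delta {suc n} f (suc i) f≡0 = trans (cong (_+ sum (λ j → f (suc j))) (f≡0 zero λ ()))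
  (sum-delta (λ j → f (suc j)) i (λ j j≢i → f≡0 (suc j) (j≢i ∘ FinP.suc-injective)))

sum-const-except : ∀ {n} (f : Fin n → ℕ) i c → (∀ j → j ≢ i → f j ≡ c) → sum f + c ≡ n * c + f i
sum-const-except {suc n} f zero    c f≡c = begin
  f zero + sum (λ j → f (suc j)) + c ≡⟨ cong (λ s → f zero + s + c) rest ⟩
  f zero + n * c + c                 ≡⟨ +-assoc (f zero) (n * c) c ⟩
  f zero + (n * c + c)               ≡⟨ +-comm (f zero) _ ⟩
  n * c + c + f zero                 ≡⟨ cong (_+ f zero) (+-comm (n * c) c) ⟩
  c + n * c + f zero                 ∎
  where
    open ≡-Reasoning
    rest : sum (λ j → f (suc j)) ≡ n * c
    rest = trans (sum-cong-≗ {n} (λ j → f≡c (suc j) λ ())) (sum-const n c)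
sum-const-except {suc n} f (suc i) c f≡c = begin
  f zero + sum (λ j → f (suc j)) + c   ≡⟨ +-assoc (f zero) _ c ⟩
  f zero + (sum (λ j → f (suc j)) + c) ≡⟨ cong₂ _+_ (f≡c zero λ ())
    (sum-const-except (λ j → f (suc j)) i c (λ j j≢i → f≡c (suc j) (j≢i ∘ FinP.suc-injective))) ⟩
  c + (n * c + f (suc i))              ≡⟨ +-assoc c (n * c) _ ⟨
  c + n * c + f (suc i)                ∎
  where open ≡-Reasoning

sum-mono-≤ : ∀ {n} (f g : Fin n → ℕ) → (∀ i → f i ≤ g i) → sum f ≤ sum g
sum-mono-≤ {zero}  f g f≤g = ≤-refl
sum-mono-≤ {suc n} f g f≤g =
  +-mono-≤ (f≤g zero) (sum-mono-≤ (λ i → f (suc i)) (λ i → g (suc i)) (λ i → f≤g (suc i)))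

sum-pos⇒∃ : ∀ {n} (f : Fin n → ℕ) → 0 < sum f → ∃ λ i → 0 < f i
sum-pos⇒∃ {suc n} f 0<∑f with f zero in eq
... | suc _ = zero , subst (0 <_) (sym eq) (s≤s z≤n)
... | zero with sum-pos⇒∃ (λ i → f (suc i)) 0<∑f
...   | i , 0<fi = suc i , 0<fi

_≠ᵇ_ : ∀ {n} → Fin n → Fin n → Bool
i ≠ᵇ j = not ⌊ i FinP.≟ j ⌋

≠ᵇ-sym : ∀ {n} (i j : Fin n) → i ≠ᵇ j ≡ j ≠ᵇ i
≠ᵇ-sym i j = cong not (⌊⌋-⇔ (mk⇔ sym sym) (i FinP.≟ j) (j FinP.≟ i))

≢⇒≠ᵇ≡true : ∀ {n} {i j : Fin n} → i ≢ j → i ≠ᵇ j ≡ true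
≢⇒≠ᵇ≡true {i = i} {j} i≢j = cong not (⌊⌋-false (i FinP.≟ j) i≢j)

sum-𝟙-∧-select : ∀ {n} {P : Fin n → Set} (P? : ∀ t → Dec (P t)) (b : Fin n → Bool) i →
  (∀ t → P t ⇔ t ≡ i) → sum (λ t → 𝟙 (b t ∧ ⌊ P? t ⌋)) ≡ 𝟙 (b i)
sum-𝟙-∧-select P? b i P⇔≡i = begin
  sum (λ t → 𝟙 (b t ∧ ⌊ P? t ⌋))
    ≡⟨ sum-delta _ i (λ t t≢i →
         trans (cong (λ z → 𝟙 (b t ∧ z)) (⌊⌋-false (P? t) (t≢i ∘ Equivalence.to (P⇔≡i t))))
               (cong 𝟙 (BoolP.∧-zeroʳ (b t)))) ⟩
  𝟙 (b i ∧ ⌊ P? i ⌋)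
    ≡⟨ cong (λ z → 𝟙 (b i ∧ z)) (⌊⌋-true (P? i) (Equivalence.from (P⇔≡i i) refl)) ⟩
  𝟙 (b i ∧ true)
    ≡⟨ cong 𝟙 (BoolP.∧-identityʳ (b i)) ⟩
  𝟙 (b i) ∎
  where open ≡-Reasoning

sum-∧-≠ᵇ : ∀ {n} (b : Fin n → Bool) i →
  sum (λ t → 𝟙 (b t ∧ i ≠ᵇ t)) + 𝟙 (b i) ≡ sum (λ t → 𝟙 (b t))
sum-∧-≠ᵇ b i = begin
  sum (λ t → 𝟙 (b t ∧ i ≠ᵇ t)) + 𝟙 (b i)
    ≡⟨ cong (sum (λ t → 𝟙 (b t ∧ i ≠ᵇ t)) +_)
            (sym (sum-𝟙-∧-select (i FinP.≟_) b i (λ t → mk⇔ sym sym))) ⟩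
  sum (λ t → 𝟙 (b t ∧ i ≠ᵇ t)) + sum (λ t → 𝟙 (b t ∧ ⌊ i FinP.≟ t ⌋))
    ≡⟨ ∑-distrib-+ (λ t → 𝟙 (b t ∧ i ≠ᵇ t)) _ ⟨
  sum (λ t → 𝟙 (b t ∧ i ≠ᵇ t) + 𝟙 (b t ∧ ⌊ i FinP.≟ t ⌋))
    ≡⟨ sum-cong-≗ (λ t → 𝟙-∧-not+𝟙-∧ (b t) ⌊ i FinP.≟ t ⌋) ⟩
  sum (λ t → 𝟙 (b t)) ∎
  where open ≡-Reasoning

sum-∧-≠ᵇ-∸ : ∀ {n} (b : Fin n → Bool) i →
  sum (λ t → 𝟙 (b t ∧ i ≠ᵇ t)) ≡ sum (λ t → 𝟙 (b t)) ∸ 𝟙 (b i)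
sum-∧-≠ᵇ-∸ b i = sym (trans (cong (_∸ 𝟙 (b i)) (sym (sum-∧-≠ᵇ b i))) (m+n∸n≡m _ (𝟙 (b i))))

sum-≠ᵇ : ∀ {n} (i : Fin n) → sum (λ t → 𝟙 (i ≠ᵇ t)) ≡ n ∸ 1
sum-≠ᵇ {n} i = trans (sum-∧-≠ᵇ-∸ (λ _ → true) i) (cong (_∸ 1) (trans (sum-const n 1) (*-identityʳ n)))

sum-≠ᵇ-∧-≠ᵇ : ∀ {n} {i j : Fin n} → i ≢ j → sum (λ t → 𝟙 (i ≠ᵇ t ∧ j ≠ᵇ t)) ≡ n ∸ 2
sum-≠ᵇ-∧-≠ᵇ {n} {i} {j} i≢j = begin
  sum (λ t → 𝟙 (i ≠ᵇ t ∧ j ≠ᵇ t)) ≡⟨ sum-∧-≠ᵇ-∸ (i ≠ᵇ_) j ⟩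
  sum (λ t → 𝟙 (i ≠ᵇ t)) ∸ 𝟙 (i ≠ᵇ j)
    ≡⟨ cong₂ _∸_ (sum-≠ᵇ i) (cong 𝟙 (≢⇒≠ᵇ≡true i≢j)) ⟩
  n ∸ 1 ∸ 1 ≡⟨ ∸-+-assoc n 1 1 ⟩
  n ∸ 2 ∎
  where open ≡-Reasoning

one-of-two : ∀ {a b x y z : ℕ} → x ≢ y →
  x ≡ a ⊎ x ≡ b → y ≡ a ⊎ y ≡ b → z ≡ a ⊎ z ≡ b → z ≡ x ⊎ z ≡ y
one-of-two x≢y (inj₁ x≡a) (inj₁ y≡a) _          = ⊥-elim (x≢y (trans x≡a (sym y≡a)))
one-of-two x≢y (inj₂ x≡b) (inj₂ y≡b) _          = ⊥-elim (x≢y (trans x≡b (sym y≡b)))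
one-of-two _   (inj₁ x≡a) (inj₂ _)   (inj₁ z≡a) = inj₁ (trans z≡a (sym x≡a))
one-of-two _   (inj₁ _)   (inj₂ y≡b) (inj₂ z≡b) = inj₂ (trans z≡b (sym y≡b))
one-of-two _   (inj₂ _)   (inj₁ y≡a) (inj₁ z≡a) = inj₂ (trans z≡a (sym y≡a))
one-of-two _   (inj₂ x≡b) (inj₁ _)   (inj₂ z≡b) = inj₁ (trans z≡b (sym x≡b))

2*m≢2*[m∸1] : ∀ {m} → 0 < m → 2 * m ≢ 2 * (m ∸ 1)
2*m≢2*[m∸1] {suc m} _ eq = 1+n≢n (*-cancelˡ-≡ (suc m) m 2 eq)

root-pos : ∀ {n x l} → 2 ≤ n → 0 < l → x * x + l ≡ n * l + x → 0 < x
root-pos {x = suc x} _ _ _ = s≤s z≤n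
root-pos {n} {zero} {l@(suc _)} 2≤n _ eq =
  ⊥-elim (<⇒≢ (m<m*n l n 2≤n) (trans eq (trans (+-identityʳ (n * l)) (*-comm n l))))

∸2+≡⇒+≡+2 : ∀ {n m o} → 2 ≤ n → n ∸ 2 + m ≡ o → n + m ≡ o + 2
∸2+≡⇒+≡+2 {n} {m} {o} 2≤n eq = begin
  n + m         ≡⟨ cong (_+ m) (m∸n+n≡m 2≤n) ⟨
  n ∸ 2 + 2 + m ≡⟨ xy∙z≈xz∙y (n ∸ 2) 2 m ⟩
  n ∸ 2 + m + 2 ≡⟨ cong (_+ 2) eq ⟩
  o + 2         ∎
  where open ≡-Reasoning

-- The next four lemmas are quadratic-solution after substituting λ = l + 1 and n = (k + 1) + r.
k≡l+r : ∀ {k r l} → suc k + r + suc l ≡ 2 * k + 2 → k ≡ l + r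
k≡l+r {k} {r} {l} eq = +-cancelˡ-≡ k _ _ (+-cancelʳ-≡ 2 _ _ (begin
  k + k + 2         ≡⟨ cong (λ m → k + m + 2) (+-identityʳ k) ⟨
  2 * k + 2         ≡⟨ eq ⟨
  suc k + r + suc l ≡⟨ shuffle k r l ⟩
  k + (l + r) + 2   ∎))
  where
    open ≡-Reasoning
    shuffle : ∀ k r l → suc k + r + suc l ≡ k + (l + r) + 2
    shuffle = solve-∀

r²≡2l+3r : ∀ {l r} → (l + r) * (l + r) + suc l ≡ (suc (l + r) + r) * suc l + (l + r) →
  r * r ≡ 2 * l + 3 * r
r²≡2l+3r {l} {r} eq = +-cancelˡ-≡ (l * l + 2 * l * r + l + 1) _ _ (begin
  l * l + 2 * l * r + l + 1 + r * r           ≡⟨ expand-lhs l r ⟩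
  (l + r) * (l + r) + suc l                   ≡⟨ eq ⟩
  (suc (l + r) + r) * suc l + (l + r)         ≡⟨ expand-rhs l r ⟩
  l * l + 2 * l * r + l + 1 + (2 * l + 3 * r) ∎)
  where
    open ≡-Reasoning
    expand-lhs : ∀ l r → l * l + 2 * l * r + l + 1 + r * r ≡ (l + r) * (l + r) + suc l
    expand-lhs = solve-∀
    expand-rhs : ∀ l r → (suc (l + r) + r) * suc l + (l + r) ≡ l * l + 2 * l * r + l + 1 + (2 * l + 3 * r)
    expand-rhs = solve-∀

[2r+1]²≡8n∸7 : ∀ {l r} → r * r ≡ 2 * l + 3 * r → (2 * r + 1) * (2 * r + 1) ≡ 8 * (suc (l + r) + r) ∸ 7
[2r+1]²≡8n∸7 {l} {r} r²≡ = begin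
  (2 * r + 1) * (2 * r + 1)                 ≡⟨ expand-square r ⟩
  4 * (r * r) + 4 * r + 1                   ≡⟨ cong (λ q → 4 * q + 4 * r + 1) r²≡ ⟩
  4 * (2 * l + 3 * r) + 4 * r + 1           ≡⟨ m+n∸m≡n 7 _ ⟨
  7 + (4 * (2 * l + 3 * r) + 4 * r + 1) ∸ 7 ≡⟨ cong (_∸ 7) (collect l r) ⟩
  8 * (suc (l + r) + r) ∸ 7                 ∎
  where
    open ≡-Reasoning
    expand-square : ∀ r → (2 * r + 1) * (2 * r + 1) ≡ 4 * (r * r) + 4 * r + 1
    expand-square = solve-∀
    collect : ∀ l r → 7 + (4 * (2 * l + 3 * r) + 4 * r + 1) ≡ 8 * (suc (l + r) + r)
    collect = solve-∀

2k+[2r+1]≡2n∸1 : ∀ l r → 2 * (l + r) + (2 * r + 1) ≡ 2 * (suc (l + r) + r) ∸ 1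
2k+[2r+1]≡2n∸1 l r = begin
  2 * (l + r) + (2 * r + 1)           ≡⟨ m+n∸m≡n 1 _ ⟨
  1 + (2 * (l + r) + (2 * r + 1)) ∸ 1 ≡⟨ cong (_∸ 1) (collect l r) ⟩
  2 * (suc (l + r) + r) ∸ 1           ∎
  where
    open ≡-Reasoning
    collect : ∀ l r → 1 + (2 * (l + r) + (2 * r + 1)) ≡ 2 * (suc (l + r) + r)
    collect = solve-∀

quadratic-solution : ∀ {n k λ′} → 2 ≤ n → 0 < λ′ → k < n →
  n ∸ 2 + λ′ ≡ 2 * k → k * k + λ′ ≡ n * λ′ + k →
  Σ ℕ λ s → s * s ≡ 8 * n ∸ 7 × 2 * k + s ≡ 2 * n ∸ 1
quadratic-solution {n} {k} {suc l} 2≤n _ k<n e₁ e₂ with m≤n⇒∃[o]m+o≡n k<n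
... | r , refl with k≡l+r {k} {r} {l} (∸2+≡⇒+≡+2 2≤n e₁)
...   | refl = 2 * r + 1 , [2r+1]²≡8n∸7 {l} (r²≡2l+3r e₂) , 2k+[2r+1]≡2n∸1 l r

module DihedralGroup (n : ℕ) ⦃ nz : NonZero n ⦄ where
  open Dihedral n using (Zn; _⊕_; ⊖_; 0z; G; elems)

  private
    toℕ-mod : ∀ m → toℕ (m mod n) ≡ m % n
    toℕ-mod m = FinP.toℕ-fromℕ< (m%n<n m n)

    [m%n+o]%n≡[m+o]%n : ∀ m o → (m % n + o) % n ≡ (m + o) % n
    [m%n+o]%n≡[m+o]%n m o = begin
      (m % n + o) % n         ≡⟨ %-distribˡ-+ (m % n) o n ⟩
      (m % n % n + o % n) % n ≡⟨ cong (λ z → (z + o % n) % n) (m%n%n≡m%n m n) ⟩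
      (m % n + o % n) % n     ≡⟨ %-distribˡ-+ m o n ⟨
      (m + o) % n             ∎
      where open ≡-Reasoning

    [m+o%n]%n≡[m+o]%n : ∀ m o → (m + o % n) % n ≡ (m + o) % n
    [m+o%n]%n≡[m+o]%n m o = begin
      (m + o % n) % n ≡⟨ cong (_% n) (+-comm m (o % n)) ⟩
      (o % n + m) % n ≡⟨ [m%n+o]%n≡[m+o]%n o m ⟩
      (o + m) % n     ≡⟨ cong (_% n) (+-comm o m) ⟩
      (m + o) % n     ∎
      where open ≡-Reasoning

    toℕ-0z : toℕ 0z ≡ 0
    toℕ-0z = trans (toℕ-mod 0) (m<n⇒m%n≡m (>-nonZero⁻¹ n))

  ⊕-comm : ∀ i j → i ⊕ j ≡ j ⊕ i
  ⊕-comm i j = cong (_mod n) (+-comm (toℕ i) (toℕ j))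

  ⊕-assoc : ∀ i j k → (i ⊕ j) ⊕ k ≡ i ⊕ (j ⊕ k)
  ⊕-assoc i j k = FinP.toℕ-injective (begin
    toℕ ((i ⊕ j) ⊕ k)                 ≡⟨ toℕ-mod _ ⟩
    (toℕ (i ⊕ j) + toℕ k) % n         ≡⟨ cong (λ z → (z + toℕ k) % n) (toℕ-mod _) ⟩
    ((toℕ i + toℕ j) % n + toℕ k) % n ≡⟨ [m%n+o]%n≡[m+o]%n _ _ ⟩
    (toℕ i + toℕ j + toℕ k) % n       ≡⟨ cong (_% n) (+-assoc (toℕ i) _ _) ⟩
    (toℕ i + (toℕ j + toℕ k)) % n     ≡⟨ [m+o%n]%n≡[m+o]%n _ _ ⟨
    (toℕ i + (toℕ j + toℕ k) % n) % n ≡⟨ cong (λ z → (toℕ i + z) % n) (toℕ-mod _) ⟨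
    (toℕ i + toℕ (j ⊕ k)) % n         ≡⟨ toℕ-mod _ ⟨
    toℕ (i ⊕ (j ⊕ k))                 ∎)
    where open ≡-Reasoning

  ⊕-identityˡ : ∀ i → 0z ⊕ i ≡ i
  ⊕-identityˡ i = FinP.toℕ-injective (begin
    toℕ (0z ⊕ i)            ≡⟨ toℕ-mod _ ⟩
    (toℕ 0z + toℕ i) % n    ≡⟨ cong (λ z → (z + toℕ i) % n) toℕ-0z ⟩
    toℕ i % n               ≡⟨ m<n⇒m%n≡m (FinP.toℕ<n i) ⟩
    toℕ i                   ∎)
    where open ≡-Reasoning

  ⊕-inverseʳ : ∀ i → i ⊕ (⊖ i) ≡ 0z
  ⊕-inverseʳ i = FinP.toℕ-injective (begin
    toℕ (i ⊕ (⊖ i))                ≡⟨ toℕ-mod _ ⟩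
    (toℕ i + toℕ (⊖ i)) % n        ≡⟨ cong (λ z → (toℕ i + z) % n) (toℕ-mod _) ⟩
    (toℕ i + (n ∸ toℕ i) % n) % n  ≡⟨ [m+o%n]%n≡[m+o]%n _ _ ⟩
    (toℕ i + (n ∸ toℕ i)) % n      ≡⟨ cong (_% n) (m+[n∸m]≡n (<⇒≤ (FinP.toℕ<n i))) ⟩
    n % n                          ≡⟨ n%n≡0 n ⟩
    0                              ≡⟨ toℕ-0z ⟨
    toℕ 0z                         ∎)
    where open ≡-Reasoning

  ⊕-⊖-isAbelianGroup : IsAbelianGroup _≡_ _⊕_ 0z ⊖_
  ⊕-⊖-isAbelianGroup = record
    { isGroup = record
      { isMonoid = record
        { isSemigroup = record
          { isMagma = record { isEquivalence = isEquivalence ; ∙-cong = cong₂ _⊕_ }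
          ; assoc = ⊕-assoc
          }
        ; identity = ⊕-identityˡ , λ i → trans (⊕-comm i 0z) (⊕-identityˡ i)
        }
      ; inverse = (λ i → trans (⊕-comm (⊖ i) i) (⊕-inverseʳ i)) , ⊕-inverseʳ
      ; ⁻¹-cong = cong ⊖_
      }
    ; comm = ⊕-comm
    }

  ⊕-⊖-abelianGroup : AbelianGroup 0ℓ 0ℓ
  ⊕-⊖-abelianGroup = record { isAbelianGroup = ⊕-⊖-isAbelianGroup }

  open import Algebra.Properties.AbelianGroup ⊕-⊖-abelianGroup public
    using ( ⁻¹-involutive; ⁻¹-injective; ε⁻¹≈ε; ⁻¹-∙-comm; \\-leftDividesˡ; \\-leftDividesʳ
          ; x∙y⁻¹≈ε⇒x≈y; x≈y⇒x∙y⁻¹≈ε)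

  sum-translate : ∀ (f : Zn → ℕ) i → sum (λ t → f (i ⊕ t)) ≡ sum f
  sum-translate f i =
    sym (∑-permute f (Perm.permutation (i ⊕_) ((⊖ i) ⊕_) (\\-leftDividesˡ i) (\\-leftDividesʳ i)))

  sum-reflect : ∀ (f : Zn → ℕ) → sum (λ t → f (⊖ t)) ≡ sum f
  sum-reflect f = sym (∑-permute f (Perm.permutation ⊖_ ⊖_ ⁻¹-involutive ⁻¹-involutive))

  ⊕⊖≠ᵇ0 : ∀ i j → (i ⊕ (⊖ j)) ≠ᵇ 0z ≡ i ≠ᵇ j
  ⊕⊖≠ᵇ0 i j = cong not (⌊⌋-⇔ (mk⇔ (x∙y⁻¹≈ε⇒x≈y i j) x≈y⇒x∙y⁻¹≈ε) (_ FinP.≟ 0z) (i FinP.≟ j))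

  x≢xy : ∀ {i j : Zn} → (i , false) ≢ (j , true)
  x≢xy ()

  length-elems : length elems ≡ 2 * n
  length-elems = trans (length-cartesianProduct (allFin n) _)
    (trans (cong (_* 2) (ListP.length-tabulate {n = n} (λ i → i))) (*-comm n 2))

  ∑G : (G → ℕ) → ℕ
  ∑G h = sum (λ i → h (i , false) + h (i , true))

  ∑G-from : ∀ a h → ∑G h ≡ sum (λ t → h (t , a) + h (t , not a))
  ∑G-from false h = refl
  ∑G-from true  h = sum-cong-≗ {n} (λ t → +-comm (h (t , false)) (h (t , true)))

  ∈-elems : ∀ g → g ∈ elems
  ∈-elems (i , false) = ∈-cartesianProduct⁺ (∈-allFin i) (here refl)
  ∈-elems (i , true)  = ∈-cartesianProduct⁺ (∈-allFin i) (there (here refl))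

  sum-map-elems : ∀ h → List.sum (map h elems) ≡ ∑G h
  sum-map-elems h = begin
    List.sum (map h elems)
      ≡⟨ sum-map-cartesianProduct h (allFin n) _ ⟩
    List.sum (map (λ i → h (i , false) + (h (i , true) + 0)) (allFin n))
      ≡⟨ sum-map-tabulate {n = n} _ (λ i → i) ⟩
    sum (λ i → h (i , false) + (h (i , true) + 0))
      ≡⟨ sum-cong-≗ {n} (λ i → cong (h (i , false) +_) (+-identityʳ _)) ⟩
    ∑G h ∎
    where open ≡-Reasoning

  count-elems : ∀ p → length (filter (λ g → T? (p g)) elems) ≡ ∑G (λ g → 𝟙 (p g))
  count-elems p = trans (length-filter-T? p elems) (sum-map-elems _)

  count-elems² : ∀ p → length (filter (λ w → T? (p w)) (cartesianProduct elems elems)) ≡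
    ∑G (λ g → ∑G (λ h → 𝟙 (p (g , h))))
  count-elems² p = begin
    length (filter (λ w → T? (p w)) (cartesianProduct elems elems))
      ≡⟨ length-filter-T? p (cartesianProduct elems elems) ⟩
    List.sum (map (λ w → 𝟙 (p w)) (cartesianProduct elems elems))
      ≡⟨ sum-map-cartesianProduct _ elems elems ⟩
    List.sum (map (λ g → List.sum (map (λ h → 𝟙 (p (g , h))) elems)) elems)
      ≡⟨ sum-map-elems _ ⟩
    ∑G (λ g → List.sum (map (λ h → 𝟙 (p (g , h))) elems))
      ≡⟨ sum-cong-≗ {n} (λ i → cong₂ _+_ (sum-map-elems _) (sum-map-elems _)) ⟩
    ∑G (λ g → ∑G (λ h → 𝟙 (p (g , h)))) ∎
    where open ≡-Reasoning

module CayleyGraph (n : ℕ) ⦃ nz : NonZero n ⦄ (D : Subset n) where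
  open Dihedral n
  open DihedralGroup n

  invD : Zn → Bool
  invD t = lookup D (⊖ t)

  inD-x : ∀ i → inD D (i , false) ≡ lookup D i
  inD-x i = any-∧-unique (lookup D) (λ d → xpow d == (i , false)) (allFin n) (∈-allFin i)
    (λ d t → cong proj₁ (toWitness t)) (fromWitness refl)

  inD-xy : ∀ i → inD D (i , true) ≡ false
  inD-xy i = any-≡-false (λ d → lookup D d ∧ (xpow d == (i , true))) (allFin n)
    (λ d t → x≢xy (toWitness (proj₂ (T-∧⁻ (lookup D d) t))))

  inS-x : ∀ i → inS D (i , false) ≡ i ≠ᵇ 0z
  inS-x i = begin
    not ((i , false) == e) ∨ any (λ d → inD D d ∧ ((y · d) == (i , false))) elems
      ≡⟨ cong₂ _∨_ (cong not (⌊⌋-⇔ (mk⇔ (cong proj₁) (cong (_, false))) _ _))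
                   (any-≡-false (λ d → inD D d ∧ ((y · d) == (i , false))) elems not-y·d) ⟩
    i ≠ᵇ 0z ∨ false
      ≡⟨ BoolP.∨-identityʳ _ ⟩
    i ≠ᵇ 0z ∎
    where
      open ≡-Reasoning
      not-y·d : ∀ d → ¬ T (inD D d ∧ ((y · d) == (i , false)))
      not-y·d (j , false) t = x≢xy (sym (toWitness (proj₂ (T-∧⁻ (inD D (j , false)) t))))
      not-y·d (j , true)  t = subst T (inD-xy j) (proj₁ (T-∧⁻ (inD D (j , true)) t))

  inS-yx : ∀ i → inS D (i , true) ≡ invD i
  inS-yx i = trans
    (any-∧-unique (inD D) (λ d → (y · d) == (i , true)) elems (∈-elems (⊖ i , false)) unique
      (fromWitness (cong (_, true) (trans (⊕-identityˡ _) (⁻¹-involutive i)))))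
    (inD-x (⊖ i))
    where
      unique : ∀ d → T ((y · d) == (i , true)) → d ≡ (⊖ i , false)
      unique (j , false) t = cong (_, false)
        (trans (sym (⁻¹-involutive j)) (cong ⊖_ (trans (sym (⊕-identityˡ _)) (cong proj₁ (toWitness t)))))
      unique (j , true)  t = ⊥-elim (x≢xy (toWitness t))

  same-coset : ∀ i j → inS D (j ⊕ (⊖ i) , false) ∨ inS D (i ⊕ (⊖ j) , false) ≡ i ≠ᵇ j
  same-coset i j = begin
    inS D (j ⊕ (⊖ i) , false) ∨ inS D (i ⊕ (⊖ j) , false)
      ≡⟨ cong₂ _∨_ (trans (inS-x _) (trans (⊕⊖≠ᵇ0 j i) (≠ᵇ-sym j i))) (trans (inS-x _) (⊕⊖≠ᵇ0 i j)) ⟩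
    i ≠ᵇ j ∨ i ≠ᵇ j
      ≡⟨ BoolP.∨-idem _ ⟩
    i ≠ᵇ j ∎
    where open ≡-Reasoning

  adj-same : ∀ i a j → Graph.adj (Cay D) (i , a) (j , a) ≡ i ≠ᵇ j
  adj-same i false j = same-coset i j
  adj-same i true  j = same-coset i j

  adj-other : ∀ i a j → Graph.adj (Cay D) (i , a) (j , not a) ≡ invD (i ⊕ j)
  adj-other i false j = begin
    inS D (j ⊕ (⊖ (⊖ i)) , true) ∨ inS D (i ⊕ j , true)
      ≡⟨ cong₂ _∨_ (trans (inS-yx _) (cong invD (trans (cong (j ⊕_) (⁻¹-involutive i)) (⊕-comm j i))))
                   (inS-yx _) ⟩
    invD (i ⊕ j) ∨ invD (i ⊕ j)
      ≡⟨ BoolP.∨-idem _ ⟩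
    invD (i ⊕ j) ∎
    where open ≡-Reasoning
  adj-other i true  j = begin
    inS D (j ⊕ i , true) ∨ inS D (i ⊕ (⊖ (⊖ j)) , true)
      ≡⟨ cong₂ _∨_ (trans (inS-yx _) (cong invD (⊕-comm j i)))
                   (trans (inS-yx _) (cong invD (cong (i ⊕_) (⁻¹-involutive j)))) ⟩
    invD (i ⊕ j) ∨ invD (i ⊕ j)
      ≡⟨ BoolP.∨-idem _ ⟩
    invD (i ⊕ j) ∎
    where open ≡-Reasoning

  adj-sym : ∀ g h → Graph.adj (Cay D) g h ≡ Graph.adj (Cay D) h g
  adj-sym g h = BoolP.∨-comm (inS D (h · (g ⁻¹))) (inS D (g · (h ⁻¹)))

  private
    adj = Graph.adj (Cay D)

  k : ℕ
  k = sum (λ t → 𝟙 (invD t))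

  sum-invD-translate : ∀ i → sum (λ t → 𝟙 (invD (i ⊕ t))) ≡ k
  sum-invD-translate = sum-translate (λ t → 𝟙 (invD t))

  coincidences : Zn → ℕ
  coincidences c = sum (λ t → 𝟙 (invD t ∧ invD (c ⊕ t)))

  coincidences-translate : ∀ i j → sum (λ t → 𝟙 (invD (i ⊕ t) ∧ invD (j ⊕ t))) ≡ coincidences (j ⊕ (⊖ i))
  coincidences-translate i j = trans
    (sum-cong-≗ {n} (λ t → cong (λ s → 𝟙 (invD (i ⊕ t) ∧ invD s)) (shift t)))
    (sum-translate (λ s → 𝟙 (invD s ∧ invD ((j ⊕ (⊖ i)) ⊕ s))) i)
    where
      shift : ∀ t → j ⊕ t ≡ (j ⊕ (⊖ i)) ⊕ (i ⊕ t)
      shift t = sym (trans (⊕-assoc j (⊖ i) (i ⊕ t)) (cong (j ⊕_) (\\-leftDividesʳ i t)))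

  degree-Cay : ∀ i a → degree (Cay D) (i , a) ≡ n ∸ 1 + k
  degree-Cay i a = begin
    degree (Cay D) (i , a)
      ≡⟨ trans (count-elems _) (∑G-from a (λ w → 𝟙 (adj (i , a) w))) ⟩
    sum (λ t → 𝟙 (adj (i , a) (t , a)) + 𝟙 (adj (i , a) (t , not a)))
      ≡⟨ sum-cong-≗ {n} (λ t → cong₂ _+_ (cong 𝟙 (adj-same i a t)) (cong 𝟙 (adj-other i a t))) ⟩
    sum (λ t → 𝟙 (i ≠ᵇ t) + 𝟙 (invD (i ⊕ t)))
      ≡⟨ ∑-distrib-+ (λ t → 𝟙 (i ≠ᵇ t)) _ ⟩
    sum (λ t → 𝟙 (i ≠ᵇ t)) + sum (λ t → 𝟙 (invD (i ⊕ t)))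
      ≡⟨ cong₂ _+_ (sum-≠ᵇ i) (sum-invD-translate i) ⟩
    n ∸ 1 + k ∎
    where open ≡-Reasoning

  regular-Cay : IsRegular (Cay D) (n ∸ 1 + k)
  regular-Cay (i , a) = degree-Cay i a

  k<n : (∃ λ t → invD t ≡ false) → k < n
  k<n (t , invD-t) = begin-strict
    k                                ≡⟨ cong (λ b → k ∸ 𝟙 b) invD-t ⟨
    k ∸ 𝟙 (invD t)                   ≡⟨ sum-∧-≠ᵇ-∸ invD t ⟨
    sum (λ s → 𝟙 (invD s ∧ t ≠ᵇ s))  ≤⟨ sum-mono-≤ _ _ (λ s → 𝟙-∧-≤ʳ (invD s) (t ≠ᵇ s)) ⟩
    sum (λ s → 𝟙 (t ≠ᵇ s))           ≡⟨ sum-≠ᵇ t ⟩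
    n ∸ 1                            <⟨ ∸-monoʳ-< (s≤s z≤n) (>-nonZero⁻¹ n) ⟩
    n                                ∎
    where open ≤-Reasoning

  common-same : ∀ {i j} a → i ≢ j → common (Cay D) (i , a) (j , a) ≡ n ∸ 2 + coincidences (j ⊕ (⊖ i))
  common-same {i} {j} a i≢j = begin
    common (Cay D) (i , a) (j , a)
      ≡⟨ trans (count-elems _) (∑G-from a (λ w → 𝟙 (adj (i , a) w ∧ adj (j , a) w))) ⟩
    sum (λ t → 𝟙 (adj (i , a) (t , a) ∧ adj (j , a) (t , a))
             + 𝟙 (adj (i , a) (t , not a) ∧ adj (j , a) (t , not a)))
      ≡⟨ sum-cong-≗ {n} (λ t → cong₂ _+_
           (cong 𝟙 (cong₂ _∧_ (adj-same i a t) (adj-same j a t)))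
           (cong 𝟙 (cong₂ _∧_ (adj-other i a t) (adj-other j a t)))) ⟩
    sum (λ t → 𝟙 (i ≠ᵇ t ∧ j ≠ᵇ t) + 𝟙 (invD (i ⊕ t) ∧ invD (j ⊕ t)))
      ≡⟨ ∑-distrib-+ (λ t → 𝟙 (i ≠ᵇ t ∧ j ≠ᵇ t)) _ ⟩
    sum (λ t → 𝟙 (i ≠ᵇ t ∧ j ≠ᵇ t)) + sum (λ t → 𝟙 (invD (i ⊕ t) ∧ invD (j ⊕ t)))
      ≡⟨ cong₂ _+_ (sum-≠ᵇ-∧-≠ᵇ i≢j) (coincidences-translate i j) ⟩
    n ∸ 2 + coincidences (j ⊕ (⊖ i)) ∎
    where open ≡-Reasoning

  common-other : ∀ i a j → common (Cay D) (i , a) (j , not a) ≡ 2 * (k ∸ 𝟙 (invD (i ⊕ j)))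
  common-other i a j = begin
    common (Cay D) (i , a) (j , not a)
      ≡⟨ trans (count-elems _) (∑G-from a (λ w → 𝟙 (adj (i , a) w ∧ adj (j , not a) w))) ⟩
    sum (λ t → 𝟙 (adj (i , a) (t , a) ∧ adj (j , not a) (t , a))
             + 𝟙 (adj (i , a) (t , not a) ∧ adj (j , not a) (t , not a)))
      ≡⟨ sum-cong-≗ {n} (λ t → cong₂ _+_
           (cong 𝟙 (trans (cong₂ _∧_ (adj-same i a t) (trans (adj-sym (j , not a) (t , a)) (adj-other t a j)))
                          (BoolP.∧-comm (i ≠ᵇ t) _)))
           (cong 𝟙 (cong₂ _∧_ (adj-other i a t) (adj-same j (not a) t)))) ⟩
    sum (λ t → 𝟙 (invD (t ⊕ j) ∧ i ≠ᵇ t) + 𝟙 (invD (i ⊕ t) ∧ j ≠ᵇ t))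
      ≡⟨ ∑-distrib-+ (λ t → 𝟙 (invD (t ⊕ j) ∧ i ≠ᵇ t)) _ ⟩
    sum (λ t → 𝟙 (invD (t ⊕ j) ∧ i ≠ᵇ t)) + sum (λ t → 𝟙 (invD (i ⊕ t) ∧ j ≠ᵇ t))
      ≡⟨ cong₂ _+_ (sum-∧-≠ᵇ-∸ (λ t → invD (t ⊕ j)) i) (sum-∧-≠ᵇ-∸ (λ t → invD (i ⊕ t)) j) ⟩
    sum (λ t → 𝟙 (invD (t ⊕ j))) ∸ 𝟙 (invD (i ⊕ j))
      + (sum (λ t → 𝟙 (invD (i ⊕ t))) ∸ 𝟙 (invD (i ⊕ j)))
      ≡⟨ cong₂ (λ s s′ → s ∸ 𝟙 (invD (i ⊕ j)) + (s′ ∸ 𝟙 (invD (i ⊕ j))))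
              (trans (sum-cong-≗ {n} (λ t → cong (𝟙 ∘ invD) (⊕-comm t j))) (sum-invD-translate j))
              (sum-invD-translate i) ⟩
    (k ∸ 𝟙 (invD (i ⊕ j))) + (k ∸ 𝟙 (invD (i ⊕ j)))
      ≡⟨ cong (k ∸ 𝟙 (invD (i ⊕ j)) +_) (+-identityʳ _) ⟨
    2 * (k ∸ 𝟙 (invD (i ⊕ j))) ∎
    where open ≡-Reasoning

  differences : Zn → ℕ
  differences c = sum (λ p → 𝟙 (lookup D p ∧ lookup D (p ⊕ c)))

  DifferencePair : G → G × G → Bool
  DifferencePair h w = inD D (proj₁ w) ∧ inD D (proj₂ w) ∧ ((((proj₁ w) ⁻¹) · proj₂ w) == h)

  count-DifferencePair : ∀ c →
    length (filter (λ w → T? (DifferencePair (c , false) w)) (cartesianProduct elems elems)) ≡ differences c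
  count-DifferencePair c = begin
    length (filter (λ w → T? (DifferencePair (c , false) w)) (cartesianProduct elems elems))
      ≡⟨ count-elems² (DifferencePair (c , false)) ⟩
    ∑G (λ g → ∑G (λ h → 𝟙 (DifferencePair (c , false) (g , h))))
      ≡⟨ sum-cong-≗ {n} (λ p → cong₂ _+_
           (sum-cong-≗ {n} (λ q → cong₂ _+_ (cong 𝟙 (x-x p q)) (cong 𝟙 (x-xy p q))))
           (sum-zero _ (λ q → cong₂ _+_ (cong 𝟙 (xy-any p (q , false))) (cong 𝟙 (xy-any p (q , true)))))) ⟩
    sum (λ p → sum (λ q → 𝟙 ((lookup D p ∧ lookup D q) ∧ ⌊ (⊖ p) ⊕ q FinP.≟ c ⌋) + 0) + 0)
      ≡⟨ sum-cong-≗ {n} (λ p → trans (+-identityʳ _) (trans (sum-cong-≗ {n} (λ q → +-identityʳ _))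
           (sum-𝟙-∧-select (λ q → (⊖ p) ⊕ q FinP.≟ c) (λ q → lookup D p ∧ lookup D q) (p ⊕ c)
             (λ q → mk⇔ (λ eq → trans (sym (\\-leftDividesˡ p q)) (cong (p ⊕_) eq))
                        (λ { refl → \\-leftDividesʳ p c }))))) ⟩
    differences c ∎
    where
      open ≡-Reasoning
      x-x : ∀ p q → DifferencePair (c , false) ((p , false) , (q , false)) ≡
                    (lookup D p ∧ lookup D q) ∧ ⌊ (⊖ p) ⊕ q FinP.≟ c ⌋
      x-x p q = trans (cong₂ _∧_ (inD-x p)
        (cong₂ _∧_ (inD-x q) (⌊⌋-⇔ (mk⇔ (cong proj₁) (cong (_, false))) _ ((⊖ p) ⊕ q FinP.≟ c))))
        (sym (BoolP.∧-assoc (lookup D p) _ _))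
      x-xy : ∀ p q → DifferencePair (c , false) ((p , false) , (q , true)) ≡ false
      x-xy p q = trans (cong (λ b → inD D (p , false) ∧ (b ∧ _)) (inD-xy q)) (BoolP.∧-zeroʳ _)
      xy-any : ∀ p g → DifferencePair (c , false) ((p , true) , g) ≡ false
      xy-any p g = cong (_∧ (inD D g ∧ ((((p , true) ⁻¹) · g) == (c , false)))) (inD-xy p)

  common-other-from-0 : ∀ t → common (Cay D) (0z , false) (t , true) ≡ 2 * (k ∸ 𝟙 (invD t))
  common-other-from-0 t =
    trans (common-other 0z false t) (cong (λ s → 2 * (k ∸ 𝟙 (invD s))) (⊕-identityˡ t))

  coincidences-reflect : ∀ c → coincidences c ≡ differences (⊖ c)
  coincidences-reflect c = trans
    (sum-cong-≗ {n} (λ t → cong (λ s → 𝟙 (invD t ∧ lookup D s))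
      (trans (cong ⊖_ (⊕-comm c t)) (sym (⁻¹-∙-comm t c)))))
    (sum-reflect (λ p → 𝟙 (lookup D p ∧ lookup D (p ⊕ (⊖ c)))))

  coincidences-0 : coincidences 0z ≡ k
  coincidences-0 = sum-cong-≗ {n} λ t →
    cong 𝟙 (trans (cong (λ s → invD t ∧ invD s) (⊕-identityˡ t)) (BoolP.∧-idem (invD t)))

  sum-coincidences : sum coincidences ≡ k * k
  sum-coincidences = begin
    sum (λ c → sum (λ t → 𝟙 (invD t ∧ invD (c ⊕ t))))
      ≡⟨ ∑-comm (λ c t → 𝟙 (invD t ∧ invD (c ⊕ t))) ⟩
    sum (λ t → sum (λ c → 𝟙 (invD t ∧ invD (c ⊕ t))))
      ≡⟨ sum-cong-≗ {n} (λ t → trans (sum-cong-≗ {n} (λ c → 𝟙-∧ (invD t) (invD (c ⊕ t))))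
                                     (sym (*-distribˡ-sum (𝟙 (invD t)) (λ c → 𝟙 (invD (c ⊕ t)))))) ⟩
    sum (λ t → 𝟙 (invD t) * sum (λ c → 𝟙 (invD (c ⊕ t))))
      ≡⟨ sum-cong-≗ {n} (λ t → cong (𝟙 (invD t) *_)
           (trans (sum-cong-≗ {n} (λ c → cong (𝟙 ∘ invD) (⊕-comm c t))) (sum-invD-translate t))) ⟩
    sum (λ t → 𝟙 (invD t) * k)
      ≡⟨ *-distribʳ-sum k (λ t → 𝟙 (invD t)) ⟨
    k * k ∎
    where open ≡-Reasoning

  module _ (ds : IsDifferenceSet D) where
    λ′ : ℕ
    λ′ = proj₁ ds

    λ′-pos : 0 < λ′
    λ′-pos = proj₁ (proj₂ ds)

    coincidences-const : ∀ c → c ≢ 0z → coincidences c ≡ λ′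
    coincidences-const c c≢0 = trans (coincidences-reflect c)
      (trans (sym (count-DifferencePair (⊖ c)))
             (proj₂ (proj₂ ds) (⊖ c , false) tt
               (λ eq → c≢0 (⁻¹-injective (trans (cong proj₁ eq) (sym ε⁻¹≈ε))))))

    difference-set-equation : k * k + λ′ ≡ n * λ′ + k
    difference-set-equation = begin
      k * k + λ′ ≡⟨ cong (_+ λ′) sum-coincidences ⟨
      sum coincidences + λ′ ≡⟨ sum-const-except coincidences 0z λ′ coincidences-const ⟩
      n * λ′ + coincidences 0z ≡⟨ cong (n * λ′ +_) coincidences-0 ⟩
      n * λ′ + k ∎
      where open ≡-Reasoning

    same-coset-pair : ∀ {i j} a → i ≢ j →
      T (adj (i , a) (j , a)) × common (Cay D) (i , a) (j , a) ≡ n ∸ 2 + λ′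
    same-coset-pair {i} {j} a i≢j =
      subst T (sym (trans (adj-same i a j) (≢⇒≠ᵇ≡true i≢j))) tt ,
      trans (common-same a i≢j)
            (cong (n ∸ 2 +_) (coincidences-const _ (λ eq → i≢j (sym (x∙y⁻¹≈ε⇒x≈y j i eq)))))

    common-Cay : ∀ u v → u ≢ v →
      (T (adj u v) × common (Cay D) u v ≡ n ∸ 2 + λ′) ⊎
      (∃ λ t → adj u v ≡ invD t × common (Cay D) u v ≡ 2 * (k ∸ 𝟙 (invD t)))
    common-Cay (i , false) (j , false) u≢v = inj₁ (same-coset-pair false (u≢v ∘ cong (_, false)))
    common-Cay (i , true)  (j , true)  u≢v = inj₁ (same-coset-pair true (u≢v ∘ cong (_, true)))
    common-Cay (i , false) (j , true)  _   = inj₂ (i ⊕ j , adj-other i false j , common-other i false j)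
    common-Cay (i , true)  (j , false) _   = inj₂ (i ⊕ j , adj-other i true j , common-other i true j)

    strongly-regular : n ∸ 2 + λ′ ≡ 2 * (k ∸ 1) → IsStronglyRegular (Cay D)
    strongly-regular n∸2+λ≡2[k∸1] = n ∸ 1 + k , 2 * (k ∸ 1) , 2 * k , regular-Cay , adjacent , nonadjacent
      where
        adjacent : ∀ u v → u ≢ v → T (adj u v) → common (Cay D) u v ≡ 2 * (k ∸ 1)
        adjacent u v u≢v u~v with common-Cay u v u≢v
        ... | inj₁ (_ , c≡) = trans c≡ n∸2+λ≡2[k∸1]
        ... | inj₂ (t , adj≡ , c≡) =
          trans c≡ (cong (λ b → 2 * (k ∸ 𝟙 b)) (trans (sym adj≡) (T⇒≡true u~v)))
        nonadjacent : ∀ u v → u ≢ v → ¬ T (adj u v) → common (Cay D) u v ≡ 2 * k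
        nonadjacent u v u≢v u≁v with common-Cay u v u≢v
        ... | inj₁ (u~v , _) = ⊥-elim (u≁v u~v)
        ... | inj₂ (t , adj≡ , c≡) =
          trans c≡ (cong (λ b → 2 * (k ∸ 𝟙 b)) (trans (sym adj≡) (¬T⇒≡false u≁v)))

    deza : n ∸ 2 + λ′ ≡ 2 * k → IsDezaWith (Cay D) (2 * n) (n ∸ 1 + k) (2 * k) (2 * (k ∸ 1))
    deza n∸2+λ≡2k = length-elems , regular-Cay , two-values
      where
        two-values : ∀ u v → u ≢ v → common (Cay D) u v ≡ 2 * (k ∸ 1) ⊎ common (Cay D) u v ≡ 2 * k
        two-values u v u≢v with common-Cay u v u≢v
        ... | inj₁ (_ , c≡) = inj₂ (trans c≡ n∸2+λ≡2k)
        ... | inj₂ (t , _ , c≡) with invD t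
        ...   | true  = inj₁ c≡
        ...   | false = inj₂ c≡

    invD-false : IsStrictlyDeza (Cay D) → ∃ λ t → invD t ≡ false
    invD-false (_ , _ , _ , u , v , u≢v , u≁v) with common-Cay u v u≢v
    ... | inj₁ (u~v , _) = ⊥-elim (u≁v u~v)
    ... | inj₂ (t , adj≡ , _) = t , trans (sym adj≡) (¬T⇒≡false u≁v)

    k-pos : 3 ≤ n → 0 < k
    k-pos 3≤n = root-pos (<⇒≤ 3≤n) λ′-pos difference-set-equation

    invD-true : 3 ≤ n → ∃ λ t → invD t ≡ true
    invD-true 3≤n with sum-pos⇒∃ (λ t → 𝟙 (invD t)) (k-pos 3≤n)
    ... | t , 0<𝟙 = t , 𝟙-pos⇒≡true 0<𝟙

    key-equation : 3 ≤ n → IsStrictlyDeza (Cay D) → n ∸ 2 + λ′ ≡ 2 * k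
    key-equation 3≤n sd@((_ , b , a , _ , _ , two-values) , ¬srg , _)
      with invD-false sd | invD-true 3≤n
    ... | tA , invD-tA | tB , invD-tB =
      [ (λ eq → eq) , ⊥-elim ∘ ¬srg ∘ strongly-regular ]′
        (one-of-two (2*m≢2*[m∸1] (k-pos 3≤n)) (value-at {tA} invD-tA) (value-at {tB} invD-tB)
                    same-coset-value)
      where
        value-at : ∀ {t c} → invD t ≡ c → 2 * (k ∸ 𝟙 c) ≡ a ⊎ 2 * (k ∸ 𝟙 c) ≡ b
        value-at {t} invD-t = subst (λ x → x ≡ a ⊎ x ≡ b)
          (trans (common-other-from-0 t) (cong (λ c → 2 * (k ∸ 𝟙 c)) invD-t))
          (two-values (0z , false) (t , true) x≢xy)
        tA≢tB : tA ≢ tB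
        tA≢tB tA≡tB with trans (sym invD-tA) (trans (cong invD tA≡tB) invD-tB)
        ... | ()
        same-coset-value : n ∸ 2 + λ′ ≡ a ⊎ n ∸ 2 + λ′ ≡ b
        same-coset-value = subst (λ x → x ≡ a ⊎ x ≡ b) (proj₂ (same-coset-pair false tA≢tB))
          (two-values (tA , false) (tB , false) (tA≢tB ∘ cong proj₁))

lemma3p2 : (n : ℕ) ⦃ nz : NonZero n ⦄ → 3 ≤ n → (D : Subset n) →
  Dihedral.IsDifferenceSet n D →
  IsStrictlyDeza (Dihedral.Cay n D) →
  Σ ℕ λ k → Σ ℕ λ s →
    s * s ≡ 8 * n ∸ 7 × 2 * k + s ≡ 2 * n ∸ 1 ×
    IsDezaWith (Dihedral.Cay n D) (2 * n) (n ∸ 1 + k) (2 * k) (2 * (k ∸ 1))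
lemma3p2 n 3≤n D ds sd =
  let open CayleyGraph n D
      n∸2+λ≡2k = key-equation ds 3≤n sd
      (s , s²≡8n∸7 , 2k+s≡2n∸1) = quadratic-solution (<⇒≤ 3≤n) (λ′-pos ds) (k<n (invD-false ds sd))
                                    n∸2+λ≡2k (difference-set-equation ds)
  in k , s , s²≡8n∸7 , 2k+s≡2n∸1 , deza ds n∸2+λ≡2k
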